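{- Let $b\ge 4$ and $n\ge 1$ be integers, let $d$ be a positive integer with $d<b^{1/3}$, and let $c$ be an integer with $0\le c<d$ and $\gcd(c,d)=1$. Put $\alpha=\sqrt{b/d^3}$ and assume $\alpha\ge n^{3/2}+n$. Let $a$ be an integer with $\gcd(a,b)=1$ and $0<a-b\cdot c/d\le \alpha/n-1$. For each positive divisor $r$ of $n$ and $j\in\{0,\dots,r-1\}$ put $k(r,j)=\gcd(\frac nr a+jb, rb)$, $m(r,j)=\gcd(\frac nr c+jd, rd)$, $a(r,j)=(\frac nr a+jb)/k(r,j)$, $b(r,j)=rb/k(r,j)$, $c(r,j)=(\frac nr c+jd)/m(r,j)$, $d(r,j)=rd/m(r,j)$, $q(r,j)=a(r,j)d(r,j)-b(r,j)c(r,j)$ and $E[r,j]=\frac{b(r,j)}{d(r,j)q(r,j)}$; let also $E(a,b)=\frac{b}{d(ad-bc)}$. Then each $m(r,j)$ divides $n$. Conversely, for every positive divisor $m$ of $n$, $$\#\left\{(r,j):\ r\mid n,\ j\in\{0,\dots,r-1\},\ E[r,j]=\frac{m^2}{n}E(a,b)\right\}=\frac nm .$$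
   Context: Here $r$ ranges over positive divisors of $n$. The quantities $E(a,b)$ and $E[r,j]$ are the "expected values" of the normalized Dedekind sums $S(a,b)$ and $S(\frac nr a+jb, rb)$ near the Farey points $b\cdot c/d$ and $b(r,j)\cdot c(r,j)/d(r,j)$ respectively. -}

module Defs where

open import Data.Nat as ℕ using (ℕ; zero; suc)
open import Data.Nat.Divisibility using (_∣?_)
import Data.Nat.DivMod as ℕD
open import Data.Nat.GCD using (gcd)
open import Data.Integer as ℤ using (ℤ; +_; ∣_∣)
import Data.Integer.DivMod as ℤD
open import Data.List using (List; []; _∷_; map; upTo; concatMap; filter; length)
open import Data.Product using (_×_; _,_)
open import Relation.Nullary using (yes; no; Dec)
open import Relation.Binary.PropositionalEquality using (_≡_)

-- Natural-number division, total: x // 0 = 0 (only ever used with nonzero divisor).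
_//_ : ℕ → ℕ → ℕ
x // zero  = 0
x // suc k = x ℕD./ suc k

-- Integer division by a natural, total: x /ℤ 0 = 0 (only used with nonzero divisor).
_/ℤ_ : ℤ → ℕ → ℤ
x /ℤ zero  = + 0
x /ℤ suc k = x ℤD./ℕ suc k

module _ (n : ℕ) (a : ℤ) (b c d : ℕ) where

  num : ℕ → ℕ → ℤ
  num r j = (+ (n // r)) ℤ.* a ℤ.+ (+ (j ℕ.* b))

  numc : ℕ → ℕ → ℕ
  numc r j = (n // r) ℕ.* c ℕ.+ j ℕ.* d

  kk : ℕ → ℕ → ℕ
  kk r j = gcd ∣ num r j ∣ (r ℕ.* b)

  mm : ℕ → ℕ → ℕ
  mm r j = gcd (numc r j) (r ℕ.* d)

  aR : ℕ → ℕ → ℤ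
  aR r j = num r j /ℤ kk r j

  bR : ℕ → ℕ → ℕ
  bR r j = (r ℕ.* b) // kk r j

  cR : ℕ → ℕ → ℕ
  cR r j = numc r j // mm r j

  dR : ℕ → ℕ → ℕ
  dR r j = (r ℕ.* d) // mm r j

  qR : ℕ → ℕ → ℤ
  qR r j = aR r j ℤ.* (+ dR r j) ℤ.- (+ bR r j) ℤ.* (+ cR r j)

  -- The equation  E[r,j] = (m^2/n) E(a,b), where
  --   E[r,j] = b(r,j) / (d(r,j) q(r,j))  and  E(a,b) = b / (d (ad - bc)),
  -- written with denominators cleared:
  --   b(r,j) * n * d (ad - bc)  =  m^2 * b * d(r,j) q(r,j).
  -- (If q(r,j) = 0 then E[r,j] is undefined and the equation is false, since
  --  the left side is nonzero under the hypotheses.)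
  EEq : ℕ → ℕ → ℕ → Set
  EEq m r j =
    (+ bR r j) ℤ.* (+ n) ℤ.* ((+ d) ℤ.* (a ℤ.* (+ d) ℤ.- (+ b) ℤ.* (+ c)))
      ≡ (+ (m ℕ.* m)) ℤ.* (+ b) ℤ.* ((+ dR r j) ℤ.* qR r j)

  pairs : List (ℕ × ℕ)
  pairs = concatMap (λ r → divPairs r (r ∣? n)) (map suc (upTo n))
    where
    divPairs : (r : ℕ) → _ → List (ℕ × ℕ)
    divPairs r (yes _) = map (λ j → (r , j)) (upTo r)
    divPairs r (no _)  = []

  countE : ℕ → ℕ
  countE m = length (filter decE pairs)
    where
    P : ℕ × ℕ → Set
    P (r , j) = EEq m r j
    decE : (p : ℕ × ℕ) → Dec (P p)
    decE (r , j) = (+ bR r j) ℤ.* (+ n) ℤ.* ((+ d) ℤ.* (a ℤ.* (+ d) ℤ.- (+ b) ℤ.* (+ c)))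
                     ℤ.≟ (+ (m ℕ.* m)) ℤ.* (+ b) ℤ.* ((+ dR r j) ℤ.* qR r j)

module Submission where

-- Only b, n, d ≥ 1, gcd(c,d) = 1 and ad − bc > 0 are used.
--
-- For (ii), the identity
-- q(r,j)·k(r,j)·m(r,j) = n(ad − bc) shows that the E-equation holds exactly when
-- m(r,j) = m (`Reduction`), so we must count the fibre of the content map over m.  The
-- pair (r, j) is the Hermite normal form of a lattice of index n in ℤ²; attaching to it
-- a "height" (`HeightLattice`) that is injective modulo n/m on the fibre bounds each
-- fibre by n/m (`FibreBound`).  Comparing with the cofactor map (r, j) ↦ n/r, whose
-- fibre over m has exactly n/m elements and whose fibres have the same total size,
-- turns the bounds into equalities (`ExactCount`).

open import Defs
open import Data.Nat as ℕ using (ℕ; _^_)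
open import Data.Nat.Divisibility using (_∣_)
open import Data.Nat.GCD using (gcd)
open import Data.Integer as ℤ using (ℤ; +_; ∣_∣)
open import Data.Product using (_×_; _,_)
open import Relation.Binary.PropositionalEquality using (_≡_; refl)

module Quotients where

  open import Data.Nat using (zero; suc; _≤_; _*_; z≤n; s≤s)
  import Data.Nat.Properties as ℕP
  import Data.Nat.DivMod as ℕD
  open import Data.Nat.GCD using (gcd[m,n]≢0)
  import Data.Integer.Properties as ℤP
  open import Data.Sum using (inj₂)
  open import Data.Empty using (⊥-elim)
  open import Relation.Binary.PropositionalEquality

  //-inverse : ∀ {r n} → 1 ≤ r → r ∣ n → r * (n // r) ≡ n
  //-inverse {suc r} _ r∣n = ℕD.m*[n/m]≡n r∣n

  //-inverseʳ : ∀ {r n} → 1 ≤ r → r ∣ n → (n // r) * r ≡ n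
  //-inverseʳ {r} {n} r≥1 r∣n = trans (ℕP.*-comm (n // r) r) (//-inverse r≥1 r∣n)

  //-unique : ∀ {r n q} → 1 ≤ r → r * q ≡ n → n // r ≡ q
  //-unique {suc r} {n} {q} _ e =
    trans (cong (ℕD._/ suc r) (trans (sym e) (ℕP.*-comm (suc r) q))) (ℕD.m*n/n≡m q (suc r))

  +//-inverse : ∀ {r n} → 1 ≤ r → r ∣ n → + (n // r) ℤ.* + r ≡ + n
  +//-inverse {r} {n} r≥1 r∣n = trans (sym (ℤP.pos-* (n // r) r)) (cong +_ (//-inverseʳ r≥1 r∣n))

  /ℤ-inverse : ∀ {r n} → 1 ≤ r → r ∣ n → ((+ n) /ℤ r) ℤ.* + r ≡ + n
  /ℤ-inverse {suc r} {n} _ r∣n = trans (sym (ℤP.pos-* (n ℕD./ suc r) (suc r))) (cong +_ (ℕD.m/n*n≡m r∣n))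

  cofactor-pos : ∀ {n r s} → 1 ≤ n → r * s ≡ n → 1 ≤ s
  cofactor-pos {r = r} {zero} n≥1 e = ⊥-elim (ℕP.<⇒≢ n≥1 (sym (trans (sym e) (ℕP.*-zeroʳ r))))
  cofactor-pos {s = suc s} _ _ = s≤s z≤n

  gcd-pos : ∀ x {y} → 1 ≤ y → 1 ≤ gcd x y
  gcd-pos x {y} y≥1 = ℕP.n≢0⇒n>0 (gcd[m,n]≢0 x y (inj₂ (λ y≡0 → ℕP.<⇒≢ y≥1 (sym y≡0))))

module Counting where

  open import Data.Nat using (suc; _≤_; _<_; _+_; z≤n; _≟_)
  import Data.Nat.Properties as ℕP
  open import Data.List using (List; []; _∷_; _++_; [_]; filter; length; concatMap; upTo)
  import Data.List.Properties as LP
  open import Data.List.Relation.Unary.All as All using (All; []; _∷_)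
  open import Data.List.Relation.Unary.Any using (here; there)
  open import Data.List.Relation.Unary.Unique.Propositional using (Unique)
  open import Data.List.Relation.Unary.AllPairs using (_∷_)
  import Data.List.Relation.Unary.Unique.Propositional.Properties as Unique
  open import Data.List.Membership.Propositional using (_∈_)
  import Data.List.Membership.Propositional.Properties as ∈
  open import Data.Product using (_,_)
  open import Data.Sum using (inj₁; inj₂)
  open import Data.Empty using (⊥-elim)
  open import Function.Bundles using (_⇔_; Equivalence)
  open import Relation.Nullary using (¬_; yes; no)
  open import Relation.Unary using (Pred; Decidable)
  open import Level using (0ℓ)
  open import Relation.Binary.PropositionalEquality hiding ([_])
  open import Data.Nat.Tactic.RingSolver using (solve-∀)

  #[_] : {A : Set} {Q : Pred A 0ℓ} → Decidable Q → List A → ℕ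
  #[ Q? ] xs = length (filter Q? xs)

  sumOver : List ℕ → (ℕ → ℕ) → ℕ
  sumOver []       g = 0
  sumOver (m ∷ Ds) g = g m + sumOver Ds g

  module _ {A : Set} where

    #-cong : {P Q : Pred A 0ℓ} (P? : Decidable P) (Q? : Decidable Q) {xs : List A} →
             All (λ x → P x ⇔ Q x) xs → #[ P? ] xs ≡ #[ Q? ] xs
    #-cong P? Q? {[]} [] = refl
    #-cong P? Q? {x ∷ xs} (P⇔Q ∷ h) with P? x | Q? x
    ... | yes _  | yes _  = cong suc (#-cong P? Q? h)
    ... | yes p  | no ¬q  = ⊥-elim (¬q (Equivalence.to P⇔Q p))
    ... | no ¬p  | yes q  = ⊥-elim (¬p (Equivalence.from P⇔Q q))
    ... | no _   | no _   = #-cong P? Q? h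

    #-++ : {Q : Pred A 0ℓ} (Q? : Decidable Q) (xs ys : List A) → #[ Q? ] (xs ++ ys) ≡ #[ Q? ] xs + #[ Q? ] ys
    #-++ Q? xs ys = trans (cong length (LP.filter-++ Q? xs ys)) (LP.length-++ (filter Q? xs))


    #-none : {Q : Pred A 0ℓ} (Q? : Decidable Q) {xs : List A} → All (λ x → ¬ Q x) xs → #[ Q? ] xs ≡ 0
    #-none Q? h = cong length (LP.filter-none Q? h)

    #-all : {Q : Pred A 0ℓ} (Q? : Decidable Q) {xs : List A} → All Q xs → #[ Q? ] xs ≡ length xs
    #-all Q? h = cong length (LP.filter-all Q? h)

    #-concatMap : {Q : Pred A 0ℓ} (Q? : Decidable Q) (g : ℕ → List A) (rs : List ℕ) →
                  #[ Q? ] (concatMap g rs) ≡ sumOver rs (λ r → #[ Q? ] (g r))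
    #-concatMap Q? g []       = refl
    #-concatMap Q? g (r ∷ rs) = trans (#-++ Q? (g r) (concatMap g rs)) (cong (λ k → #[ Q? ] (g r) + k) (#-concatMap Q? g rs))

  sumOver-cong : {g h : ℕ → ℕ} (Ds : List ℕ) → All (λ m → g m ≡ h m) Ds → sumOver Ds g ≡ sumOver Ds h
  sumOver-cong []       []       = refl
  sumOver-cong (m ∷ Ds) (e ∷ es) = cong₂ _+_ e (sumOver-cong Ds es)

  sumOver-+ : (g h : ℕ → ℕ) (Ds : List ℕ) → sumOver Ds (λ m → g m + h m) ≡ sumOver Ds g + sumOver Ds h
  sumOver-+ g h []       = refl
  sumOver-+ g h (m ∷ Ds) = trans (cong (λ k → g m + h m + k) (sumOver-+ g h Ds)) (interchange (g m) (h m) _ _)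
    where
    interchange : ∀ a b c d → a + b + (c + d) ≡ a + c + (b + d)
    interchange = solve-∀

  sumOver-zero : {g : ℕ → ℕ} (Ds : List ℕ) → All (λ m → g m ≡ 0) Ds → sumOver Ds g ≡ 0
  sumOver-zero []       []       = refl
  sumOver-zero (m ∷ Ds) (e ∷ es) = cong₂ _+_ e (sumOver-zero Ds es)

  sumOver-single : {g : ℕ → ℕ} (Ds : List ℕ) {r₀ : ℕ} → Unique Ds → r₀ ∈ Ds →
                   (∀ {r} → r ∈ Ds → r ≢ r₀ → g r ≡ 0) → sumOver Ds g ≡ g r₀
  sumOver-single {g} (m ∷ Ds) (m∉Ds ∷ _) (here refl) vanish =
    trans (cong (λ k → g _ + k) (sumOver-zero Ds (All.tabulate λ r∈ → vanish (there r∈) λ { refl → All.lookup m∉Ds r∈ refl })))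
          (ℕP.+-identityʳ _)
  sumOver-single {g} (m ∷ Ds) (m∉Ds ∷ u) (there r₀∈) vanish =
    trans (cong (λ k → k + sumOver Ds g) (vanish (here refl) λ { refl → All.lookup m∉Ds r₀∈ refl }))
          (sumOver-single Ds u r₀∈ (λ r∈ → vanish (there r∈)))

  sumOver-mono : {g h : ℕ → ℕ} (Ds : List ℕ) → All (λ m → g m ≤ h m) Ds → sumOver Ds g ≤ sumOver Ds h
  sumOver-mono []       []       = z≤n
  sumOver-mono (m ∷ Ds) (e ∷ es) = ℕP.+-mono-≤ e (sumOver-mono Ds es)

  sumOver-tight : {g h : ℕ → ℕ} (Ds : List ℕ) → All (λ m → g m ≤ h m) Ds →
                  sumOver Ds g ≡ sumOver Ds h → All (λ m → g m ≡ h m) Ds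
  sumOver-tight []       []       _   = []
  sumOver-tight {g} {h} (m ∷ Ds) (e ∷ es) tot with ℕP.m≤n⇒m<n∨m≡n e
  ... | inj₂ eq = eq ∷ sumOver-tight Ds es (ℕP.+-cancelˡ-≡ (g m) _ _ (trans tot (cong (_+ sumOver Ds h) (sym eq))))
  ... | inj₁ lt = ⊥-elim (ℕP.<⇒≢ (ℕP.+-mono-<-≤ lt (sumOver-mono Ds es)) tot)

  module _ {A : Set} (f : A → ℕ) where

    fibre : ℕ → List A → ℕ
    fibre m = #[ (λ x → f x ≟ m) ]

    fibres-partition : (Ds : List ℕ) → Unique Ds → (xs : List A) → All (λ x → f x ∈ Ds) xs →
                       sumOver Ds (λ m → fibre m xs) ≡ length xs
    fibres-partition Ds u []       _         = sumOver-zero Ds (All.tabulate λ _ → refl)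
    fibres-partition Ds u (x ∷ xs) (fx∈ ∷ h) = begin
      sumOver Ds (λ m → fibre m ([ x ] ++ xs))       ≡⟨ sumOver-cong Ds (All.tabulate λ {m} _ → #-++ (λ y → f y ≟ m) [ x ] xs) ⟩
      sumOver Ds (λ m → fibre m [ x ] + fibre m xs)  ≡⟨ sumOver-+ (λ m → fibre m [ x ]) (λ m → fibre m xs) Ds ⟩
      sumOver Ds (λ m → fibre m [ x ]) + sumOver Ds (λ m → fibre m xs)
                                                      ≡⟨ cong₂ _+_ (sumOver-single Ds u fx∈ off-value) (fibres-partition Ds u xs h) ⟩
      fibre (f x) [ x ] + length xs                   ≡⟨ cong (_+ length xs) (#-all (λ y → f y ≟ f x) (refl ∷ [])) ⟩
      suc (length xs)                                 ∎
      where
      open ≡-Reasoning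
      off-value : ∀ {m} → m ∈ Ds → m ≢ f x → fibre m [ x ] ≡ 0
      off-value {m} _ m≢fx = #-none (λ y → f y ≟ m) ((λ fx≡m → m≢fx (sym fx≡m)) ∷ [])

    fibre-≤1 : (i : ℕ) (xs : List A) → Unique xs →
               (∀ {x y} → x ∈ xs → y ∈ xs → f x ≡ f y → x ≡ y) → fibre i xs ≤ 1
    fibre-≤1 i []       _           _   = z≤n
    fibre-≤1 i (x ∷ xs) (x∉xs ∷ u) inj with f x ≟ i
    ... | yes fx≡i = ℕP.≤-reflexive (trans (cong length (LP.filter-accept (λ y → f y ≟ i) fx≡i))
                       (cong suc (#-none _ (All.tabulate λ y∈ fy≡i →
                         All.lookup x∉xs y∈ (inj (here refl) (there y∈) (trans fx≡i (sym fy≡i)))))))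
    ... | no fx≢i  = subst (_≤ 1) (sym (cong length (LP.filter-reject (λ y → f y ≟ i) fx≢i)))
                       (fibre-≤1 i xs u (λ x∈ y∈ → inj (there x∈) (there y∈)))

    #-pigeonhole : {Q : Pred A 0ℓ} (Q? : Decidable Q) (t : ℕ) (xs : List A) → Unique xs →
                   (∀ {x} → x ∈ xs → Q x → f x < t) →
                   (∀ {x y} → x ∈ xs → y ∈ xs → Q x → Q y → f x ≡ f y → x ≡ y) → #[ Q? ] xs ≤ t
    #-pigeonhole Q? t xs u below inj = begin
      length F                            ≡⟨ fibres-partition (upTo t) (Unique.upTo⁺ t) F (All.tabulate f-below) ⟨
      sumOver (upTo t) (λ i → fibre i F)  ≤⟨ sumOver-mono (upTo t) (All.tabulate λ {i} _ → fibre-≤1 i F (Unique.filter⁺ Q? u) inj-F) ⟩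
      sumOver (upTo t) (λ _ → 1)          ≡⟨ sumOver-ones (upTo t) ⟩
      length (upTo t)                     ≡⟨ LP.length-upTo t ⟩
      t                                   ∎
      where
      open ℕP.≤-Reasoning
      F : List A
      F = filter Q? xs
      f-below : ∀ {x} → x ∈ F → f x ∈ upTo t
      f-below x∈F = let (x∈xs , qx) = ∈.∈-filter⁻ Q? x∈F in ∈.∈-upTo⁺ (below x∈xs qx)
      inj-F : ∀ {x y} → x ∈ F → y ∈ F → f x ≡ f y → x ≡ y
      inj-F x∈F y∈F = let (x∈xs , qx) = ∈.∈-filter⁻ Q? x∈F ; (y∈xs , qy) = ∈.∈-filter⁻ Q? y∈F in inj x∈xs y∈xs qx qy
      sumOver-ones : (Ds : List ℕ) → sumOver Ds (λ _ → 1) ≡ length Ds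
      sumOver-ones []       = refl
      sumOver-ones (_ ∷ Ds) = cong suc (sumOver-ones Ds)

  fibres-dominated : {A : Set} (f g : A → ℕ) (Ds : List ℕ) → Unique Ds → (xs : List A) →
                     All (λ x → f x ∈ Ds) xs → All (λ x → g x ∈ Ds) xs →
                     All (λ m → fibre f m xs ≤ fibre g m xs) Ds → All (λ m → fibre f m xs ≡ fibre g m xs) Ds
  fibres-dominated f g Ds u xs f∈ g∈ f≤g =
    sumOver-tight Ds f≤g (trans (fibres-partition f Ds u xs f∈) (sym (fibres-partition g Ds u xs g∈)))

module IndexSet where

  open Quotients
  open Counting
  open import Data.Nat using (suc; _≤_; _<_; _*_; z≤n; s≤s)
  import Data.Nat.Properties as ℕP
  open import Data.Nat.Divisibility using (_∣?_; divides; ∣⇒≤)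
  open import Data.List using (List; []; map; upTo; concat; concatMap)
  import Data.List.Properties as LP
  open import Data.List.Relation.Unary.All as All using (All)
  import Data.List.Relation.Unary.All.Properties as All
  import Data.List.Relation.Unary.Any as Any
  open import Data.List.Relation.Unary.Any.Properties using (¬Any[])
  import Data.List.Relation.Unary.AllPairs as AllPairs
  import Data.List.Relation.Unary.AllPairs.Properties as AllPairs
  open import Data.List.Relation.Unary.Unique.Propositional using (Unique)
  import Data.List.Relation.Unary.Unique.Propositional.Properties as Unique
  open import Data.List.Membership.Propositional using (_∈_)
  import Data.List.Membership.Propositional.Properties as ∈
  open import Data.List.Relation.Binary.Disjoint.Propositional using (Disjoint)
  open import Data.Product using (Σ; _,_; proj₁; proj₂)
  open import Data.Empty using (⊥-elim)
  open import Relation.Nullary using (yes; no)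
  open import Relation.Binary.PropositionalEquality

  candidates : ℕ → List ℕ
  candidates n = map suc (upTo n)

  block : ℕ → ℕ → List (ℕ × ℕ)
  block n r with r ∣? n
  ... | yes _ = map (r ,_) (upTo r)
  ... | no _  = []

  indexPairs : ℕ → List (ℕ × ℕ)
  indexPairs n = concatMap (block n) (candidates n)

  Admissible : ℕ → ℕ × ℕ → Set
  Admissible n (r , j) = 1 ≤ r × r ∣ n × j < r

  -- `pairs` is definitionally a concatenation of blocks, through a local helper of Defs;
  -- `pairs-blocks` exposes that helper so that it can be compared with `block`
  pairs-blocks : ∀ n a b c d → Σ (ℕ → List (ℕ × ℕ)) λ G → pairs n a b c d ≡ concatMap G (candidates n)
  pairs-blocks n a b c d = _ , refl

  pairs-block : ∀ n a b c d r → proj₁ (pairs-blocks n a b c d) r ≡ block n r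
  pairs-block n a b c d r with r ∣? n
  ... | yes _ = refl
  ... | no _  = refl

  pairs≡indexPairs : ∀ n a b c d → pairs n a b c d ≡ indexPairs n
  pairs≡indexPairs n a b c d =
    trans (proj₂ (pairs-blocks n a b c d)) (cong concat (LP.map-cong (pairs-block n a b c d) (candidates n)))

  candidates-unique : ∀ n → Unique (candidates n)
  candidates-unique n = Unique.map⁺ ℕP.suc-injective (Unique.upTo⁺ n)

  ∈-candidates⁺ : ∀ {n m} → 1 ≤ m → m ≤ n → m ∈ candidates n
  ∈-candidates⁺ {m = suc m} _ m≤n = ∈.∈-map⁺ suc (∈.∈-upTo⁺ m≤n)

  ∈-candidates⁻ : ∀ {n m} → m ∈ candidates n → 1 ≤ m
  ∈-candidates⁻ m∈ with ∈.∈-map⁻ suc m∈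
  ... | _ , _ , refl = s≤s z≤n

  divisor∈candidates : ∀ {n m} → 1 ≤ n → 1 ≤ m → m ∣ n → m ∈ candidates n
  divisor∈candidates n≥1 m≥1 m∣n = ∈-candidates⁺ m≥1 (∣⇒≤ {{ℕ.>-nonZero n≥1}} m∣n)

  block-full : ∀ {n r} → r ∣ n → block n r ≡ map (r ,_) (upTo r)
  block-full {n} {r} r∣n with r ∣? n
  ... | yes _   = refl
  ... | no r∤n = ⊥-elim (r∤n r∣n)

  ∈-block⁻ : ∀ {n r p} → p ∈ block n r → proj₁ p ≡ r × r ∣ n × proj₂ p < r
  ∈-block⁻ {n} {r} p∈ with r ∣? n
  ... | no _ = ⊥-elim (¬Any[] p∈)
  ... | yes r∣n with ∈.∈-map⁻ (r ,_) p∈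
  ...   | j , j∈ , refl = refl , r∣n , ∈.∈-upTo⁻ j∈

  block-unique : ∀ n r → Unique (block n r)
  block-unique n r with r ∣? n
  ... | yes _ = Unique.map⁺ (cong proj₂) (Unique.upTo⁺ r)
  ... | no _  = AllPairs.[]

  ∈-indexPairs⁻ : ∀ {n p} → p ∈ indexPairs n → Admissible n p
  ∈-indexPairs⁻ {n} p∈ with Any.satisfied (∈.∈-concatMap⁻ (block n) {xs = candidates n} p∈)
  ... | r , p∈block with ∈-block⁻ {n} {r} p∈block
  ...   | refl , r∣n , j<r = ℕP.<-≤-trans (s≤s z≤n) j<r , r∣n , j<r

  indexPairs-unique : ∀ n → Unique (indexPairs n)
  indexPairs-unique n =
    Unique.concat⁺ (All.map⁺ (All.tabulate λ {r} _ → block-unique n r))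
                   (AllPairs.map⁺ (AllPairs.map disjoint (candidates-unique n)))
    where
    disjoint : ∀ {r r'} → r ≢ r' → Disjoint (block n r) (block n r')
    disjoint r≢r' (p∈ , p∈') = r≢r' (trans (sym (proj₁ (∈-block⁻ p∈))) (proj₁ (∈-block⁻ p∈')))

  cofactor : ℕ → ℕ × ℕ → ℕ
  cofactor n (r , _) = n // r

  -- the number of index pairs with n / r = m is n / m: exactly the block r = n / m
  #-cofactor : ∀ {n m} → 1 ≤ n → 1 ≤ m → m ∣ n → fibre (cofactor n) m (indexPairs n) ≡ n // m
  #-cofactor {n} {m} n≥1 m≥1 m∣n =
    trans (#-concatMap _ (block n) (candidates n))
          (trans (sumOver-single (candidates n) (candidates-unique n) r₀∈ other-blocks) block-r₀)
    where
    r₀ : ℕ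
    r₀ = n // m
    mr₀≡n : m * r₀ ≡ n
    mr₀≡n = //-inverse m≥1 m∣n
    r₀∣n : r₀ ∣ n
    r₀∣n = divides m (sym mr₀≡n)
    r₀≥1 : 1 ≤ r₀
    r₀≥1 = cofactor-pos {r = m} n≥1 mr₀≡n
    r₀∈ : r₀ ∈ candidates n
    r₀∈ = divisor∈candidates n≥1 r₀≥1 r₀∣n
    block-r₀ : fibre (cofactor n) m (block n r₀) ≡ r₀
    block-r₀ rewrite block-full r₀∣n =
      trans (#-all _ (All.tabulate on-block)) (trans (LP.length-map (r₀ ,_) (upTo r₀)) (LP.length-upTo r₀))
      where
      on-block : ∀ {p} → p ∈ map (r₀ ,_) (upTo r₀) → cofactor n p ≡ m
      on-block p∈ with ∈.∈-map⁻ (r₀ ,_) p∈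
      ... | _ , _ , refl = //-unique r₀≥1 (trans (ℕP.*-comm r₀ m) mr₀≡n)
    other-blocks : ∀ {r} → r ∈ candidates n → r ≢ r₀ → fibre (cofactor n) m (block n r) ≡ 0
    other-blocks {r} r∈ r≢r₀ = #-none _ (All.tabulate off)
      where
      off : ∀ {p} → p ∈ block n r → cofactor n p ≢ m
      off p∈ n/r≡m with ∈-block⁻ {n} {r} p∈
      ... | refl , r∣n , _ = r≢r₀ (sym (//-unique m≥1 (begin
        m * r            ≡⟨ cong (_* r) (sym n/r≡m) ⟩
        (n // r) * r     ≡⟨ //-inverseʳ (∈-candidates⁻ r∈) r∣n ⟩
        n                ∎)))
        where open ≡-Reasoning

-- Part (i): m(r,j) = gcd((n/r)c + jd, rd) divides n.  Indeed it divides
-- r·((n/r)c + jd) − j·(rd) = nc and (n/r)·(rd) = nd, hence gcd(nc, nd) = n·gcd(c,d) = n.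
module ContentDividesN where

  open Quotients
  open import Data.Nat using (_≤_; _+_; _*_)
  import Data.Nat.Properties as ℕP
  open import Data.Nat.Divisibility using (∣m+n∣m⇒∣n; ∣n⇒∣m*n)
  open import Data.Nat.GCD using (gcd[m,n]∣m; gcd[m,n]∣n; gcd-greatest; c*gcd[m,n]≡gcd[cm,cn])
  open import Relation.Binary.PropositionalEquality
  open import Data.Nat.Tactic.RingSolver using (solve-∀)

  content∣n : ∀ n (a : ℤ) b c d r j → 1 ≤ r → r ∣ n → gcd c d ≡ 1 → mm n a b c d r j ∣ n
  content∣n n a b c d r j r≥1 r∣n c⊥d = subst (g ∣_) gcd[nc,nd]≡n (gcd-greatest g∣nc g∣nd)
    where
    s = n // r
    g = mm n a b c d r j
    g∣num : g ∣ s * c + j * d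
    g∣num = gcd[m,n]∣m _ _
    g∣rd : g ∣ r * d
    g∣rd = gcd[m,n]∣n (numc n a b c d r j) _
    expand-nc : r * (s * c + j * d) ≡ j * (r * d) + n * c
    expand-nc = trans (ring r s c j d) (cong (λ k → j * (r * d) + k * c) (//-inverse r≥1 r∣n))
      where ring : ∀ r s c j d → r * (s * c + j * d) ≡ j * (r * d) + r * s * c
            ring = solve-∀
    expand-nd : s * (r * d) ≡ n * d
    expand-nd = trans (ring r s d) (cong (_* d) (//-inverse r≥1 r∣n))
      where ring : ∀ r s d → s * (r * d) ≡ r * s * d
            ring = solve-∀
    g∣nc : g ∣ n * c
    g∣nc = ∣m+n∣m⇒∣n (subst (g ∣_) expand-nc (∣n⇒∣m*n r g∣num)) (∣n⇒∣m*n j g∣rd)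
    g∣nd : g ∣ n * d
    g∣nd = subst (g ∣_) expand-nd (∣n⇒∣m*n s g∣rd)
    gcd[nc,nd]≡n : gcd (n * c) (n * d) ≡ n
    gcd[nc,nd]≡n = trans (sym (c*gcd[m,n]≡gcd[cm,cn] n c d)) (trans (cong (n *_) c⊥d) (ℕP.*-identityʳ n))

-- Writing K = k(r,j),
-- M = m(r,j) and Q = ad − bc, one has q(r,j)·K·M = n·Q (the determinant of the
-- reduced pair scales by the two contents), so multiplying both sides of the
-- cleared equation `EEq` by K·M² turns it into X·M² = X·m² with X = r b n d Q ≠ 0.
module Reduction where

  open import Data.Integer using (_*_; _+_; _-_)
  open import Relation.Binary.PropositionalEquality
  open import Data.Integer.Tactic.RingSolver using (solve-∀)

  module Clearing (a' b' c' d' K M s j r N A B C D m : ℤ)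
    (a'K : a' * K ≡ s * A + j * B) (b'K : b' * K ≡ r * B)
    (c'M : c' * M ≡ s * C + j * D) (d'M : d' * M ≡ r * D) (rs : r * s ≡ N) where

    open ≡-Reasoning

    determinant-scaling : (a' * d' - b' * c') * K * M ≡ N * (A * D - B * C)
    determinant-scaling = begin
      (a' * d' - b' * c') * K * M                              ≡⟨ regroup a' d' b' c' K M ⟩
      (a' * K) * (d' * M) - (b' * K) * (c' * M)                ≡⟨ cong₂ (λ u v → u * (d' * M) - v * (c' * M)) a'K b'K ⟩
      (s * A + j * B) * (d' * M) - (r * B) * (c' * M)          ≡⟨ cong₂ (λ u v → (s * A + j * B) * u - (r * B) * v) d'M c'M ⟩
      (s * A + j * B) * (r * D) - (r * B) * (s * C + j * D)    ≡⟨ expand s A j B r D C ⟩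
      (r * s) * (A * D - B * C)                                ≡⟨ cong (_* (A * D - B * C)) rs ⟩
      N * (A * D - B * C)                                      ∎
      where
      regroup : ∀ a' d' b' c' K M → (a' * d' - b' * c') * K * M ≡ (a' * K) * (d' * M) - (b' * K) * (c' * M)
      regroup = solve-∀
      expand : ∀ s A j B r D C → (s * A + j * B) * (r * D) - (r * B) * (s * C + j * D) ≡ (r * s) * (A * D - B * C)
      expand = solve-∀

    -- the common value of both sides of `EEq` after multiplication by K·M², up to the factor M² resp. m²
    X : ℤ
    X = r * B * N * D * (A * D - B * C)

    lhs-scaled : b' * N * (D * (A * D - B * C)) * (K * M * M) ≡ X * (M * M)
    lhs-scaled = begin
      b' * N * (D * (A * D - B * C)) * (K * M * M)   ≡⟨ regroup b' N D A B C K M ⟩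
      (b' * K) * N * D * (A * D - B * C) * (M * M)   ≡⟨ cong (λ u → u * N * D * (A * D - B * C) * (M * M)) b'K ⟩
      X * (M * M)                                    ∎
      where
      regroup : ∀ b' N D A B C K M → b' * N * (D * (A * D - B * C)) * (K * M * M) ≡ (b' * K) * N * D * (A * D - B * C) * (M * M)
      regroup = solve-∀

    rhs-scaled : m * m * B * (d' * (a' * d' - b' * c')) * (K * M * M) ≡ X * (m * m)
    rhs-scaled = begin
      m * m * B * (d' * (a' * d' - b' * c')) * (K * M * M)   ≡⟨ regroup m B d' a' b' c' K M ⟩
      m * m * B * (d' * M) * ((a' * d' - b' * c') * K * M)   ≡⟨ cong₂ (λ u v → m * m * B * u * v) d'M determinant-scaling ⟩
      m * m * B * (r * D) * (N * (A * D - B * C))            ≡⟨ regroup′ m B r D N A C ⟩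
      X * (m * m)                                            ∎
      where
      regroup : ∀ m B d' a' b' c' K M → m * m * B * (d' * (a' * d' - b' * c')) * (K * M * M) ≡ m * m * B * (d' * M) * ((a' * d' - b' * c') * K * M)
      regroup = solve-∀
      regroup′ : ∀ m B r D N A C → m * m * B * (r * D) * (N * (A * D - B * C)) ≡ r * B * N * D * (A * D - B * C) * (m * m)
      regroup′ = solve-∀

  open Quotients
  open import Data.Nat using (suc; _≤_)
  import Data.Nat.Properties as ℕP
  open import Data.Nat.GCD using (gcd[m,n]∣m; gcd[m,n]∣n)
  open import Data.Integer using (_<_; NonZero)
  import Data.Integer.Properties as ℤP
  open import Data.Empty using (⊥-elim)
  open import Function.Bundles using (_⇔_; mk⇔)
  open import Relation.Binary.Definitions using (tri<; tri≈; tri>)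

  square-injective : ∀ x y → x ℕ.* x ≡ y ℕ.* y → x ≡ y
  square-injective x y e with ℕP.<-cmp x y
  ... | tri≈ _ x≡y _ = x≡y
  ... | tri< x<y _ _ = ⊥-elim (ℕP.<⇒≢ (ℕP.*-mono-< x<y x<y) e)
  ... | tri> _ _ x>y = ⊥-elim (ℕP.<⇒≢ (ℕP.*-mono-< x>y x>y) (sym e))

  pos-nonZero : ∀ {x} → 1 ≤ x → NonZero (+ x)
  pos-nonZero {suc x} _ = _

  module _ (n A b c d r j m : ℕ) (n≥1 : 1 ≤ n) (b≥1 : 1 ≤ b) (d≥1 : 1 ≤ d) (r≥1 : 1 ≤ r) (r∣n : r ∣ n)
           (Q>0 : + 0 < + A * + d - + b * + c) where

    private
      a : ℤ
      a = + A
      s K M : ℕ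
      s = n // r
      K = kk n a b c d r j
      M = mm n a b c d r j

      K≥1 : 1 ≤ K
      K≥1 = gcd-pos ∣ num n a b c d r j ∣ (ℕP.*-mono-≤ r≥1 b≥1)
      M≥1 : 1 ≤ M
      M≥1 = gcd-pos (numc n a b c d r j) (ℕP.*-mono-≤ r≥1 d≥1)

      num≡ : num n a b c d r j ≡ + (s ℕ.* A ℕ.+ j ℕ.* b)
      num≡ = trans (cong (_+ + (j ℕ.* b)) (sym (ℤP.pos-* s A))) (sym (ℤP.pos-+ (s ℕ.* A) (j ℕ.* b)))

      a'K : aR n a b c d r j * + K ≡ + s * + A + + j * + b
      a'K = begin
        (num n a b c d r j /ℤ K) * + K           ≡⟨ cong (λ z → (z /ℤ K) * + K) num≡ ⟩
        ((+ (s ℕ.* A ℕ.+ j ℕ.* b)) /ℤ K) * + K ≡⟨ /ℤ-inverse K≥1 (subst (K ∣_) (cong ∣_∣ num≡) (gcd[m,n]∣m _ (r ℕ.* b))) ⟩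
        + (s ℕ.* A ℕ.+ j ℕ.* b)                  ≡⟨ ℤP.pos-+ (s ℕ.* A) (j ℕ.* b) ⟩
        + (s ℕ.* A) + + (j ℕ.* b)                ≡⟨ cong₂ _+_ (ℤP.pos-* s A) (ℤP.pos-* j b) ⟩
        + s * + A + + j * + b                    ∎
        where open ≡-Reasoning

      b'K : + bR n a b c d r j * + K ≡ + r * + b
      b'K = trans (+//-inverse K≥1 (gcd[m,n]∣n ∣ num n a b c d r j ∣ (r ℕ.* b))) (ℤP.pos-* r b)

      c'M : + cR n a b c d r j * + M ≡ + s * + c + + j * + d
      c'M = trans (+//-inverse M≥1 (gcd[m,n]∣m _ (r ℕ.* d)))
                  (trans (ℤP.pos-+ (s ℕ.* c) (j ℕ.* d)) (cong₂ _+_ (ℤP.pos-* s c) (ℤP.pos-* j d)))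

      d'M : + dR n a b c d r j * + M ≡ + r * + d
      d'M = trans (+//-inverse M≥1 (gcd[m,n]∣n (numc n a b c d r j) _)) (ℤP.pos-* r d)

      rs : + r * + s ≡ + n
      rs = trans (sym (ℤP.pos-* r s)) (cong +_ (//-inverse r≥1 r∣n))

      open Clearing (aR n a b c d r j) (+ bR n a b c d r j) (+ cR n a b c d r j) (+ dR n a b c d r j)
                    (+ K) (+ M) (+ s) (+ j) (+ r) (+ n) (+ A) (+ b) (+ c) (+ d) (+ m) a'K b'K c'M d'M rs

      instance
        X≢0 : NonZero X
        X≢0 = ℤP.i*j≢0 (+ r * + b * + n * + d) (+ A * + d - + b * + c) {{rbnd≢0}} {{ℤ.>-nonZero Q>0}}
          where
          rbnd≢0 : NonZero (+ r * + b * + n * + d)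
          rbnd≢0 = ℤP.i*j≢0 (+ r * + b * + n) (+ d) {{rbn≢0}} {{pos-nonZero d≥1}}
            where
            rbn≢0 : NonZero (+ r * + b * + n)
            rbn≢0 = ℤP.i*j≢0 (+ r * + b) (+ n) {{ℤP.i*j≢0 (+ r) (+ b) {{pos-nonZero r≥1}} {{pos-nonZero b≥1}}}} {{pos-nonZero n≥1}}
        KMM≢0 : NonZero (+ K * + M * + M)
        KMM≢0 = ℤP.i*j≢0 (+ K * + M) (+ M) {{ℤP.i*j≢0 (+ K) (+ M) {{pos-nonZero K≥1}} {{pos-nonZero M≥1}}}} {{pos-nonZero M≥1}}

      -- `EEq` with the literal m·m of Defs rewritten as the product of integers m·m
      EEq′ : ∀ x → EEq n a b c d x r j ≡
             (+ bR n a b c d r j * + n * (+ d * (a * + d - + b * + c))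
                ≡ + x * + x * + b * (+ dR n a b c d r j * qR n a b c d r j))
      EEq′ x = cong (λ u → _ ≡ u * + b * (+ dR n a b c d r j * qR n a b c d r j)) (ℤP.pos-* x x)

    EEq⇔content : EEq n a b c d m r j ⇔ M ≡ m
    EEq⇔content = mk⇔ to from
      where
      to : EEq n a b c d m r j → M ≡ m
      to eq = square-injective M m (ℤP.+-injective (begin
        + (M ℕ.* M)          ≡⟨ ℤP.pos-* M M ⟩
        + M * + M            ≡⟨ ℤP.*-cancelˡ-≡ X _ _ (trans (sym lhs-scaled)
                                  (trans (cong (_* (+ K * + M * + M)) (subst (λ T → T) (EEq′ m) eq)) rhs-scaled)) ⟩
        + m * + m            ≡⟨ ℤP.pos-* m m ⟨
        + (m ℕ.* m)          ∎))
        where open ≡-Reasoning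
      from : M ≡ m → EEq n a b c d m r j
      from refl = subst (λ T → T) (sym (EEq′ M))
                    (ℤP.*-cancelʳ-≡ _ _ (+ K * + M * + M) (trans lhs-scaled (sym rhs-scaled)))

-- Fix m ∣ n and put t = n/m.  The pair (r, j) with s = n/r
-- determines the lattice L(r,j) = {(α s, α j + β r) : α, β ∈ ℤ} of index n in ℤ².  When
-- m(r,j) = m, Bézout gives y = (a₁ s, a₁ j + b₁ r) ∈ L(r,j) with (c,d)·y = m, and we
-- write y = m·x + I·(d, −c) where (c,d)·x = 1: the "height" I.  We show that the height
-- modulo t determines (r, j): if two heights agree modulo t, each lattice contains the
-- generator (s, j) of the other, which pins down the Hermite normal form (r, j).
module HeightLattice where

  open import Data.Integer using (_*_; _+_; _-_; -_; NonZero)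
  import Data.Integer.Properties as ℤP
  open import Data.Product using (Σ; _,_)
  open import Relation.Binary.PropositionalEquality
  open import Data.Integer.Tactic.RingSolver using (solve-∀)

  InLattice : ℤ → ℤ → ℤ → ℤ → ℤ → Set
  InLattice s j r u v = Σ ℤ λ α → Σ ℤ λ β → (u ≡ α * s) × (v ≡ α * j + β * r)

  lattice-combination : ∀ {s j r u v u' v'} (p q : ℤ) → InLattice s j r u v → InLattice s j r u' v' →
                        InLattice s j r (p * u + q * u') (p * v + q * v')
  lattice-combination {s} {j} {r} p q (α , β , refl , refl) (α' , β' , refl , refl) =
    p * α + q * α' , p * β + q * β' , ring₁ p q α α' s , ring₂ p q α α' β β' j r
    where
    ring₁ : ∀ p q α α' s → p * (α * s) + q * (α' * s) ≡ (p * α + q * α') * s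
    ring₁ = solve-∀
    ring₂ : ∀ p q α α' β β' j r → p * (α * j + β * r) + q * (α' * j + β' * r) ≡ (p * α + q * α') * j + (p * β + q * β') * r
    ring₂ = solve-∀

  module Heights (c d x₁ x₂ : ℤ) (bezout : x₁ * c + x₂ * d ≡ + 1) (M T N : ℤ) .{{M≢0 : NonZero M}} (MT≡N : M * T ≡ N) where

    open ≡-Reasoning

    record Datum : Set where
      field
        s j r a₁ b₁ c′ d′ : ℤ
        rs≡N     : r * s ≡ N
        bezout-M : a₁ * (s * c + j * d) + b₁ * (r * d) ≡ M
        c′-spec  : M * c′ ≡ s * c + j * d
        d′-spec  : M * d′ ≡ r * d

    module _ (D : Datum) where
      open Datum D

      y₁ y₂ height : ℤ
      y₁ = a₁ * s
      y₂ = a₁ * j + b₁ * r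
      height = y₁ * x₂ - y₂ * x₁

      y∈L : InLattice s j r y₁ y₂
      y∈L = a₁ , b₁ , refl , refl

      y₁-split : y₁ ≡ M * x₁ + height * d
      y₁-split = begin
        a₁ * s                                                 ≡⟨ ℤP.*-identityʳ (a₁ * s) ⟨
        a₁ * s * + 1                                           ≡⟨ cong (a₁ * s *_) bezout ⟨
        a₁ * s * (x₁ * c + x₂ * d)                             ≡⟨ ring a₁ s c j d b₁ r x₁ x₂ ⟩
        (a₁ * (s * c + j * d) + b₁ * (r * d)) * x₁ + height * d ≡⟨ cong (λ u → u * x₁ + height * d) bezout-M ⟩
        M * x₁ + height * d                                    ∎
        where
        ring : ∀ a₁ s c j d b₁ r x₁ x₂ → a₁ * s * (x₁ * c + x₂ * d) ≡
               (a₁ * (s * c + j * d) + b₁ * (r * d)) * x₁ + (a₁ * s * x₂ - (a₁ * j + b₁ * r) * x₁) * d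
        ring = solve-∀

      y₂-split : y₂ ≡ M * x₂ - height * c
      y₂-split = begin
        a₁ * j + b₁ * r                                        ≡⟨ ℤP.*-identityʳ _ ⟨
        (a₁ * j + b₁ * r) * + 1                                ≡⟨ cong ((a₁ * j + b₁ * r) *_) bezout ⟨
        (a₁ * j + b₁ * r) * (x₁ * c + x₂ * d)                  ≡⟨ ring a₁ s c j d b₁ r x₁ x₂ ⟩
        (a₁ * (s * c + j * d) + b₁ * (r * d)) * x₂ - height * c ≡⟨ cong (λ u → u * x₂ - height * c) bezout-M ⟩
        M * x₂ - height * c                                    ∎
        where
        ring : ∀ a₁ s c j d b₁ r x₁ x₂ → (a₁ * j + b₁ * r) * (x₁ * c + x₂ * d) ≡
               (a₁ * (s * c + j * d) + b₁ * (r * d)) * x₂ - (a₁ * s * x₂ - (a₁ * j + b₁ * r) * x₁) * c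
        ring = solve-∀

      s-decomposition : s ≡ c′ * y₁ + b₁ * (T * d)
      s-decomposition = ℤP.*-cancelˡ-≡ M _ _ (begin
        M * s                                        ≡⟨ ℤP.*-comm M s ⟩
        s * M                                        ≡⟨ cong (s *_) bezout-M ⟨
        s * (a₁ * (s * c + j * d) + b₁ * (r * d))    ≡⟨ ring s a₁ c j d b₁ r ⟩
        (s * c + j * d) * (a₁ * s) + b₁ * (r * s) * d ≡⟨ cong₂ (λ u v → u * (a₁ * s) + b₁ * v * d) c′-spec (trans MT≡N (sym rs≡N)) ⟨
        (M * c′) * (a₁ * s) + b₁ * (M * T) * d       ≡⟨ ring′ M c′ a₁ s b₁ T d ⟩
        M * (c′ * (a₁ * s) + b₁ * (T * d))           ∎)
        where
        ring : ∀ s a₁ c j d b₁ r → s * (a₁ * (s * c + j * d) + b₁ * (r * d)) ≡ (s * c + j * d) * (a₁ * s) + b₁ * (r * s) * d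
        ring = solve-∀
        ring′ : ∀ M c′ a₁ s b₁ T d → (M * c′) * (a₁ * s) + b₁ * (M * T) * d ≡ M * (c′ * (a₁ * s) + b₁ * (T * d))
        ring′ = solve-∀

      j-decomposition : j ≡ c′ * y₂ + b₁ * (- (T * c))
      j-decomposition = ℤP.*-cancelˡ-≡ M _ _ (begin
        M * j                                                      ≡⟨ ℤP.*-comm M j ⟩
        j * M                                                      ≡⟨ cong (j *_) bezout-M ⟨
        j * (a₁ * (s * c + j * d) + b₁ * (r * d))                  ≡⟨ ring s a₁ c j d b₁ r ⟩
        (s * c + j * d) * (a₁ * j + b₁ * r) - b₁ * (r * s) * c     ≡⟨ cong₂ (λ u v → u * (a₁ * j + b₁ * r) - b₁ * v * c) c′-spec (trans MT≡N (sym rs≡N)) ⟨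
        (M * c′) * (a₁ * j + b₁ * r) - b₁ * (M * T) * c            ≡⟨ ring′ M c′ a₁ j b₁ r T c ⟩
        M * (c′ * (a₁ * j + b₁ * r) + b₁ * (- (T * c)))            ∎)
        where
        ring : ∀ s a₁ c j d b₁ r → j * (a₁ * (s * c + j * d) + b₁ * (r * d)) ≡ (s * c + j * d) * (a₁ * j + b₁ * r) - b₁ * (r * s) * c
        ring = solve-∀
        ring′ : ∀ M c′ a₁ j b₁ r T c → (M * c′) * (a₁ * j + b₁ * r) - b₁ * (M * T) * c ≡ M * (c′ * (a₁ * j + b₁ * r) + b₁ * (- (T * c)))
        ring′ = solve-∀

      T[d,-c]∈L : InLattice s j r (T * d) (- (T * c))
      T[d,-c]∈L = d′ , - c′ , first , second
        where
        first : T * d ≡ d′ * s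
        first = ℤP.*-cancelˡ-≡ M _ _ (begin
          M * (T * d)      ≡⟨ ℤP.*-assoc M T d ⟨
          M * T * d        ≡⟨ cong (_* d) (trans MT≡N (sym rs≡N)) ⟩
          r * s * d        ≡⟨ ring r s d M d′ ⟩
          (r * d) * s      ≡⟨ cong (_* s) d′-spec ⟨
          (M * d′) * s     ≡⟨ ℤP.*-assoc M d′ s ⟩
          M * (d′ * s)     ∎)
          where
          ring : ∀ r s d M d′ → r * s * d ≡ (r * d) * s
          ring = solve-∀
        second : - (T * c) ≡ d′ * j + (- c′) * r
        second = ℤP.*-cancelˡ-≡ M _ _ (begin
          M * - (T * c)                        ≡⟨ ring M T c ⟩
          - (M * T * c)                        ≡⟨ cong (λ u → - (u * c)) (trans MT≡N (sym rs≡N)) ⟩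
          - (r * s * c)                        ≡⟨ ring′ r s c j d ⟩
          (r * d) * j - (s * c + j * d) * r    ≡⟨ cong₂ (λ u v → u * j - v * r) d′-spec c′-spec ⟨
          (M * d′) * j - (M * c′) * r          ≡⟨ ring″ M d′ j c′ r ⟩
          M * (d′ * j + (- c′) * r)            ∎)
          where
          ring : ∀ M T c → M * - (T * c) ≡ - (M * T * c)
          ring = solve-∀
          ring′ : ∀ r s c j d → - (r * s * c) ≡ (r * d) * j - (s * c + j * d) * r
          ring′ = solve-∀
          ring″ : ∀ M d′ j c′ r → (M * d′) * j - (M * c′) * r ≡ M * (d′ * j + (- c′) * r)
          ring″ = solve-∀

    congruent-heights : (D D′ : Datum) (e : ℤ) → height D - height D′ ≡ T * e →
                        InLattice (Datum.s D′) (Datum.j D′) (Datum.r D′) (Datum.s D) (Datum.j D)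
    congruent-heights D D′ e h-h′ =
      subst₂ (InLattice (Datum.s D′) (Datum.j D′) (Datum.r D′)) (sym s≡) (sym j≡)
             (lattice-combination c′ B (y∈L D′) (T[d,-c]∈L D′))
      where
      open Datum D using (c′; b₁)
      h≡ : height D ≡ height D′ + T * e
      h≡ = trans (ring (height D) (height D′)) (cong (λ k → height D′ + k) h-h′)
        where ring : ∀ h h′ → h ≡ h′ + (h - h′)
              ring = solve-∀
      B : ℤ
      B = b₁ + c′ * e
      s≡ : Datum.s D ≡ c′ * y₁ D′ + B * (T * d)
      s≡ = begin
        Datum.s D                                 ≡⟨ s-decomposition D ⟩
        c′ * y₁ D + b₁ * (T * d)                  ≡⟨ cong (λ u → c′ * u + b₁ * (T * d)) (y₁-split D) ⟩
        c′ * (M * x₁ + height D * d) + b₁ * (T * d) ≡⟨ cong (λ h → c′ * (M * x₁ + h * d) + b₁ * (T * d)) h≡ ⟩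
        c′ * (M * x₁ + (height D′ + T * e) * d) + b₁ * (T * d) ≡⟨ ring c′ M x₁ (height D′) T e d b₁ ⟩
        c′ * (M * x₁ + height D′ * d) + B * (T * d) ≡⟨ cong (λ u → c′ * u + B * (T * d)) (y₁-split D′) ⟨
        c′ * y₁ D′ + B * (T * d)                  ∎
        where
        ring : ∀ c′ M x₁ h′ T e d b₁ → c′ * (M * x₁ + (h′ + T * e) * d) + b₁ * (T * d) ≡
               c′ * (M * x₁ + h′ * d) + (b₁ + c′ * e) * (T * d)
        ring = solve-∀
      j≡ : Datum.j D ≡ c′ * y₂ D′ + B * (- (T * c))
      j≡ = begin
        Datum.j D                                 ≡⟨ j-decomposition D ⟩
        c′ * y₂ D + b₁ * (- (T * c))              ≡⟨ cong (λ u → c′ * u + b₁ * (- (T * c))) (y₂-split D) ⟩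
        c′ * (M * x₂ - height D * c) + b₁ * (- (T * c)) ≡⟨ cong (λ h → c′ * (M * x₂ - h * c) + b₁ * (- (T * c))) h≡ ⟩
        c′ * (M * x₂ - (height D′ + T * e) * c) + b₁ * (- (T * c)) ≡⟨ ring c′ M x₂ (height D′) T e c b₁ ⟩
        c′ * (M * x₂ - height D′ * c) + B * (- (T * c)) ≡⟨ cong (λ u → c′ * u + B * (- (T * c))) (y₂-split D′) ⟨
        c′ * y₂ D′ + B * (- (T * c))              ∎
        where
        ring : ∀ c′ M x₂ h′ T e c b₁ → c′ * (M * x₂ - (h′ + T * e) * c) + b₁ * (- (T * c)) ≡
               c′ * (M * x₂ - h′ * c) + (b₁ + c′ * e) * (- (T * c))
        ring = solve-∀

module IntegerFacts where

  open Quotients using (cofactor-pos)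
  open Reduction using (pos-nonZero)
  open HeightLattice using (InLattice)
  open import Data.Nat using (zero; suc; _≤_; _<_)
  import Data.Nat.Properties as ℕP
  open import Data.Nat.Divisibility using (divides; ∣-antisym)
  open import Data.Nat.GCD using (gcd-GCD; module Bézout)
  open import Data.Integer using (-[1+_]; _*_; _+_; _-_; -_)
  import Data.Integer.Properties as ℤP
  import Data.Integer.DivMod as ℤD
  open import Data.Product using (Σ; _,_)
  open import Data.Empty using (⊥-elim)
  open import Relation.Binary.PropositionalEquality
  open import Data.Integer.Tactic.RingSolver using (solve-∀)

  ℕ-difference : ∀ {g p q} → g ℕ.+ q ≡ p → + p - + q ≡ + g
  ℕ-difference {g} {p} {q} refl = trans (cong (_- + q) (ℤP.pos-+ g q)) (cancel (+ g) (+ q))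
    where cancel : ∀ x y → x + y - y ≡ x
          cancel = solve-∀

  bezout : ∀ x y → Σ ℤ λ u → Σ ℤ λ v → u * + x + v * + y ≡ + gcd x y
  bezout x y with Bézout.identity (gcd-GCD x y)
  ... | Bézout.+- u v g+vy≡ux = + u , - + v , (begin
    + u * + x + - + v * + y       ≡⟨ ring (+ u) (+ x) (+ v) (+ y) ⟩
    + u * + x - + v * + y         ≡⟨ cong₂ _-_ (ℤP.pos-* u x) (ℤP.pos-* v y) ⟨
    + (u ℕ.* x) - + (v ℕ.* y)     ≡⟨ ℕ-difference g+vy≡ux ⟩
    + gcd x y                     ∎)
    where
    open ≡-Reasoning
    ring : ∀ u x v y → u * x + - v * y ≡ u * x - v * y
    ring = solve-∀
  ... | Bézout.-+ u v g+ux≡vy = - + u , + v , (begin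
    - + u * + x + + v * + y       ≡⟨ ring (+ u) (+ x) (+ v) (+ y) ⟩
    + v * + y - + u * + x         ≡⟨ cong₂ _-_ (ℤP.pos-* v y) (ℤP.pos-* u x) ⟨
    + (v ℕ.* y) - + (u ℕ.* x)     ≡⟨ ℕ-difference g+ux≡vy ⟩
    + gcd x y                     ∎)
    where
    open ≡-Reasoning
    ring : ∀ u x v y → - u * x + v * y ≡ v * y - u * x
    ring = solve-∀

  -- the least nonnegative residue of z modulo t (the value for t = 0 is irrelevant)
  _mod_ : ℤ → ℕ → ℕ
  z mod zero  = 0
  z mod suc t = z ℤD.%ℕ suc t

  mod-< : ∀ z {t} → 1 ≤ t → z mod t < t
  mod-< z {suc t} _ = ℤD.n%ℕd<d z (suc t)

  mod-≡ : ∀ z z′ {t} → 1 ≤ t → z mod t ≡ z′ mod t → Σ ℤ λ e → z - z′ ≡ + t * e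
  mod-≡ z z′ {suc t} _ same = z ℤD./ℕ suc t - z′ ℤD./ℕ suc t , (begin
    z - z′                                               ≡⟨ cong₂ _-_ (ℤD.a≡a%ℕn+[a/ℕn]*n z (suc t)) (ℤD.a≡a%ℕn+[a/ℕn]*n z′ (suc t)) ⟩
    + z mod suc t + q * + suc t - (+ z′ mod suc t + q′ * + suc t)
                                                         ≡⟨ cong (λ ρ → + z mod suc t + q * + suc t - (+ ρ + q′ * + suc t)) same ⟨
    + z mod suc t + q * + suc t - (+ z mod suc t + q′ * + suc t)
                                                         ≡⟨ ring (+ z mod suc t) q q′ (+ suc t) ⟩
    + suc t * (q - q′)                                   ∎)
    where
    open ≡-Reasoning
    q q′ : ℤ
    q = z ℤD./ℕ suc t
    q′ = z′ ℤD./ℕ suc t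
    ring : ∀ ρ q q′ T → ρ + q * T - (ρ + q′ * T) ≡ T * (q - q′)
    ring = solve-∀

  residues-unique : ∀ {r j j′} (β : ℤ) → j < r → j′ < r → + j ≡ + j′ + β * + r → j ≡ j′
  residues-unique {r} {j} {j′} (+ k) j<r _ e = at k (ℤP.+-injective (trans e (trans (cong (λ u → + j′ + u) (sym (ℤP.pos-* k r))) (sym (ℤP.pos-+ j′ (k ℕ.* r))))))
    where
    at : ∀ k → j ≡ j′ ℕ.+ k ℕ.* r → j ≡ j′
    at zero    e′ = trans e′ (ℕP.+-identityʳ j′)
    at (suc k) e′ = ⊥-elim (ℕP.<⇒≱ j<r (subst (r ≤_) (sym e′) (ℕP.≤-trans (ℕP.m≤m+n r (k ℕ.* r)) (ℕP.m≤n+m _ j′))))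
  residues-unique {r} {j} {j′} -[1+ k ] _ j′<r e =
    ⊥-elim (ℕP.<⇒≱ j′<r (subst (r ≤_) (sym j′≡) (ℕP.≤-trans (ℕP.m≤m+n r (k ℕ.* r)) (ℕP.m≤n+m _ j))))
    where
    flip : ∀ x y β R → x ≡ y + β * R → y ≡ x + (- β) * R
    flip x y β R e = trans (ring y β R) (cong (λ u → u + (- β) * R) (sym e))
      where ring : ∀ y β R → y ≡ y + β * R + (- β) * R
            ring = solve-∀
    j′≡ : j′ ≡ j ℕ.+ suc k ℕ.* r
    j′≡ = ℤP.+-injective (trans (flip (+ j) (+ j′) -[1+ k ] (+ r) e) (trans (cong (λ u → + j + u) (sym (ℤP.pos-* (suc k) r))) (sym (ℤP.pos-+ j (suc k ℕ.* r)))))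

  hermite-unique : ∀ {n r s j r′ s′ j′} → 1 ≤ n → r ℕ.* s ≡ n → r′ ℕ.* s′ ≡ n → j < r → j′ < r′ →
                   InLattice (+ s′) (+ j′) (+ r′) (+ s) (+ j) → InLattice (+ s) (+ j) (+ r) (+ s′) (+ j′) →
                   r ≡ r′ × j ≡ j′
  hermite-unique {n} {r} {s} {j} {r′} {s′} {j′} n≥1 rs≡n r′s′≡n j<r j′<r′ (α , β , s≡ , j≡) (α′ , _ , s′≡ , _) =
    r≡r′ , j≡j′
    where
    multiple⇒∣ : ∀ {x y} (γ : ℤ) → + x ≡ γ * + y → y ∣ x
    multiple⇒∣ {y = y} γ e = divides ∣ γ ∣ (trans (cong ∣_∣ e) (ℤP.abs-* γ (+ y)))
    s≡s′ : s ≡ s′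
    s≡s′ = ∣-antisym (multiple⇒∣ α′ s′≡) (multiple⇒∣ α s≡)
    s≥1 : 1 ≤ s
    s≥1 = cofactor-pos {r = r} n≥1 rs≡n
    r≡r′ : r ≡ r′
    r≡r′ = ℕP.*-cancelʳ-≡ r r′ s {{ℕ.>-nonZero s≥1}} (trans rs≡n (sym (subst (λ u → r′ ℕ.* u ≡ n) (sym s≡s′) r′s′≡n)))
    α≡1 : α ≡ + 1
    α≡1 = ℤP.*-cancelʳ-≡ α (+ 1) (+ s) {{pos-nonZero s≥1}}
            (trans (sym (subst (λ u → + s ≡ α * + u) (sym s≡s′) s≡)) (sym (ℤP.*-identityˡ (+ s))))
    j≡j′ : j ≡ j′
    j≡j′ = residues-unique β (subst (j <_) r≡r′ j<r) j′<r′
             (trans j≡ (cong (λ u → u + β * + r′) (trans (cong (_* + j′) α≡1) (ℤP.*-identityˡ (+ j′)))))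

module FibreBound where

  open Quotients
  open Counting
  open IndexSet
  open IntegerFacts
  open HeightLattice
  open Reduction using (pos-nonZero)
  open import Data.Nat using (_≤_)
  import Data.Nat.Properties as ℕP
  open import Data.Nat.GCD using (gcd[m,n]∣m; gcd[m,n]∣n)
  open import Data.Integer using (_*_; _+_; _-_; -_)
  import Data.Integer.Properties as ℤP
  open import Data.Product using (Σ; _,_; proj₁; proj₂)
  open import Relation.Binary.PropositionalEquality
  open import Data.Integer.Tactic.RingSolver using (solve-∀)

  module _ (n : ℕ) (a : ℤ) (b c d m : ℕ) (n≥1 : 1 ≤ n) (d≥1 : 1 ≤ d) (c⊥d : gcd c d ≡ 1)
           (m≥1 : 1 ≤ m) (m∣n : m ∣ n) where

    t : ℕ
    t = n // m

    content : ℕ × ℕ → ℕ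
    content (r , j) = mm n a b c d r j

    x₁ x₂ : ℤ
    x₁ = proj₁ (bezout c d)
    x₂ = proj₁ (proj₂ (bezout c d))

    cd-bezout : x₁ * + c + x₂ * + d ≡ + 1
    cd-bezout = trans (proj₂ (proj₂ (bezout c d))) (cong +_ c⊥d)

    mt≡n : + m * + t ≡ + n
    mt≡n = trans (sym (ℤP.pos-* m t)) (cong +_ (//-inverse m≥1 m∣n))

    open Heights (+ c) (+ d) x₁ x₂ cd-bezout (+ m) (+ t) (+ n) {{pos-nonZero m≥1}} mt≡n

    a₁ b₁ : ℕ → ℕ → ℤ
    a₁ r j = proj₁ (bezout (numc n a b c d r j) (r ℕ.* d))
    b₁ r j = proj₁ (proj₂ (bezout (numc n a b c d r j) (r ℕ.* d)))

    heightAt : ℕ × ℕ → ℤ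
    heightAt (r , j) = a₁ r j * + (n // r) * x₂ - (a₁ r j * + j + b₁ r j * + r) * x₁

    datum : ∀ {r j} → Admissible n (r , j) → content (r , j) ≡ m → Datum
    datum {r} {j} (r≥1 , r∣n , _) content≡m = record
      { s = + s ; j = + j ; r = + r ; a₁ = a₁ r j ; b₁ = b₁ r j
      ; c′ = + cR n a b c d r j ; d′ = + dR n a b c d r j
      ; rs≡N = trans (sym (ℤP.pos-* r s)) (cong +_ (//-inverse r≥1 r∣n))
      ; bezout-M = trans (cong₂ (λ u v → a₁ r j * u + b₁ r j * v) (sym num≡) (sym (ℤP.pos-* r d)))
                         (trans (proj₂ (proj₂ (bezout (numc n a b c d r j) (r ℕ.* d)))) (cong +_ content≡m))
      ; c′-spec = trans (ℤP.*-comm (+ m) _) (trans (cong (λ u → + cR n a b c d r j * + u) (sym content≡m))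
                         (trans (+//-inverse M≥1 (gcd[m,n]∣m _ (r ℕ.* d))) num≡))
      ; d′-spec = trans (ℤP.*-comm (+ m) _) (trans (cong (λ u → + dR n a b c d r j * + u) (sym content≡m))
                         (trans (+//-inverse M≥1 (gcd[m,n]∣n (numc n a b c d r j) _)) (ℤP.pos-* r d)))
      }
      where
      s = n // r
      M≥1 : 1 ≤ mm n a b c d r j
      M≥1 = gcd-pos (numc n a b c d r j) (ℕP.*-mono-≤ r≥1 d≥1)
      num≡ : + numc n a b c d r j ≡ + s * + c + + j * + d
      num≡ = trans (ℤP.pos-+ (s ℕ.* c) (j ℕ.* d)) (cong₂ _+_ (ℤP.pos-* s c) (ℤP.pos-* j d))

    height-residue : ℕ × ℕ → ℕ
    height-residue p = heightAt p mod t

    t≥1 : 1 ≤ t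
    t≥1 = cofactor-pos {r = m} n≥1 (//-inverse m≥1 m∣n)

    residue-injective : ∀ {p p′} → Admissible n p → Admissible n p′ → content p ≡ m → content p′ ≡ m →
                        height-residue p ≡ height-residue p′ → p ≡ p′
    residue-injective {r , j} {r′ , j′} adm@(r≥1 , r∣n , j<r) adm′@(r′≥1 , r′∣n , j′<r′) cm cm′ same =
      cong₂ _,_ (proj₁ equal) (proj₂ equal)
      where
      difference : Σ ℤ λ e → heightAt (r , j) - heightAt (r′ , j′) ≡ + t * e
      difference = mod-≡ (heightAt (r , j)) (heightAt (r′ , j′)) t≥1 same
      e : ℤ
      e = proj₁ difference
      swap : heightAt (r′ , j′) - heightAt (r , j) ≡ + t * (- e)
      swap = trans (ring (heightAt (r , j)) (heightAt (r′ , j′))) (trans (cong -_ (proj₂ difference)) (ring′ (+ t) e))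
        where
        ring : ∀ h h′ → h′ - h ≡ - (h - h′)
        ring = solve-∀
        ring′ : ∀ T e → - (T * e) ≡ T * (- e)
        ring′ = solve-∀
      equal : r ≡ r′ × j ≡ j′
      equal = hermite-unique n≥1 (//-inverse r≥1 r∣n) (//-inverse r′≥1 r′∣n) j<r j′<r′
                (congruent-heights (datum adm cm) (datum adm′ cm′) e (proj₂ difference))
                (congruent-heights (datum adm′ cm′) (datum adm cm) (- e) swap)

    fibre-bound : fibre content m (indexPairs n) ≤ t
    fibre-bound = #-pigeonhole height-residue (λ p → content p ℕP.≟ m) t (indexPairs n) (indexPairs-unique n)
                    (λ {p} _ _ → mod-< (heightAt p) t≥1)
                    (λ p∈ p′∈ → residue-injective (∈-indexPairs⁻ p∈) (∈-indexPairs⁻ p′∈))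

-- Summed over all values in {1, …, n}, the fibres of the
-- content map p ↦ m(p) and of the cofactor map (r, j) ↦ n/r both count every index
-- pair once.  Fibre by fibre the former is at most the latter: over a divisor m of n
-- the bound n/m of `FibreBound` is the size of the cofactor fibre, and over a
-- non-divisor the content fibre is empty by part (i).  Hence all fibres agree.
module ExactCount where

  open Quotients
  open Counting
  open IndexSet
  open ContentDividesN
  open FibreBound using (fibre-bound)
  open import Data.Nat using (suc; _≤_; z≤n)
  import Data.Nat.Properties as ℕP
  open import Data.Nat.Divisibility using (_∣?_; divides)
  open import Data.Integer using (-[1+_]; _*_; _+_; _-_; _<_; +≤+)
  import Data.Integer.Properties as ℤP
  open import Data.Empty using (⊥; ⊥-elim)
  open import Data.Integer.Tactic.RingSolver using (solve-∀)
  open import Data.Product using (Σ; _,_; proj₁; proj₂)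
  open import Data.List.Relation.Unary.All as All using (All)
  open import Data.List.Membership.Propositional using (_∈_)
  open import Relation.Nullary using (yes; no)
  open import Relation.Unary using (Decidable)
  open import Relation.Binary.PropositionalEquality

  nonnegative : ∀ {a b c d} → 1 ≤ d → + 0 < a * + d - + b * + c → Σ ℕ λ A → a ≡ + A
  nonnegative {+ A} _ _ = A , refl
  nonnegative { -[1+ A ]} {b} {c} {suc d} _ Q>0 =
    ⊥-elim (negative-not-positive (subst (+ 0 <_) (cancel (-[1+ A ] * + suc d) (+ b * + c)) ad>0))
    where
    cancel : ∀ x y → x - y + y ≡ x
    cancel = solve-∀
    bc≥0 : + 0 ℤ.≤ + b * + c
    bc≥0 = subst (+ 0 ℤ.≤_) (ℤP.pos-* b c) (+≤+ z≤n)
    ad>0 : + 0 < -[1+ A ] * + suc d - + b * + c + + b * + c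
    ad>0 = ℤP.+-mono-<-≤ Q>0 bc≥0
    negative-not-positive : ∀ {x} → + 0 < -[1+ x ] → ⊥
    negative-not-positive ()

  -- `countE` counts the index pairs with a decision procedure local to Defs
  countE-unfold : ∀ n a b c d m →
                  Σ (Decidable (λ (p : ℕ × ℕ) → EEq n a b c d m (proj₁ p) (proj₂ p)))
                    λ EEq? → countE n a b c d m ≡ #[ EEq? ] (pairs n a b c d)
  countE-unfold n a b c d m = _ , refl

  module _ (n A b c d : ℕ) (n≥1 : 1 ≤ n) (b≥1 : 1 ≤ b) (d≥1 : 1 ≤ d) (c⊥d : gcd c d ≡ 1)
           (Q>0 : + 0 < + A * + d - + b * + c) where

    content : ℕ × ℕ → ℕ
    content (r , j) = mm n (+ A) b c d r j

    countE≡fibre : ∀ m → countE n (+ A) b c d m ≡ fibre content m (indexPairs n)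
    countE≡fibre m =
      trans (proj₂ (countE-unfold n (+ A) b c d m))
            (trans (cong #[ proj₁ (countE-unfold n (+ A) b c d m) ] (pairs≡indexPairs n (+ A) b c d))
                   (#-cong _ _ (All.tabulate λ {p} p∈ → let (r≥1 , r∣n , _) = ∈-indexPairs⁻ p∈ in
                      Reduction.EEq⇔content n A b c d (proj₁ p) (proj₂ p) m n≥1 b≥1 d≥1 r≥1 r∣n Q>0)))

    content∈candidates : ∀ {p} → p ∈ indexPairs n → content p ∈ candidates n
    content∈candidates {r , j} p∈ = let (r≥1 , r∣n , _) = ∈-indexPairs⁻ p∈ in
      divisor∈candidates n≥1 (gcd-pos (numc n (+ A) b c d r j) (ℕP.*-mono-≤ r≥1 d≥1))
                         (content∣n n (+ A) b c d r j r≥1 r∣n c⊥d)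

    cofactor∈candidates : ∀ {p} → p ∈ indexPairs n → cofactor n p ∈ candidates n
    cofactor∈candidates {r , _} p∈ = let (r≥1 , r∣n , _) = ∈-indexPairs⁻ p∈ ; rs≡n = //-inverse r≥1 r∣n in
      divisor∈candidates n≥1 (cofactor-pos {r = r} n≥1 rs≡n) (divides r (sym rs≡n))

    content-dominated : ∀ {m} → m ∈ candidates n → fibre content m (indexPairs n) ≤ fibre (cofactor n) m (indexPairs n)
    content-dominated {m} m∈ with m ∣? n
    ... | yes m∣n = subst (fibre content m (indexPairs n) ≤_) (sym (#-cofactor n≥1 (∈-candidates⁻ m∈) m∣n))
                      (fibre-bound n (+ A) b c d m n≥1 d≥1 c⊥d (∈-candidates⁻ m∈) m∣n)
    ... | no m∤n  = subst (_≤ fibre (cofactor n) m (indexPairs n)) (sym (#-none _ (All.tabulate λ {p} p∈ content≡m →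
                      let (r≥1 , r∣n , _) = ∈-indexPairs⁻ p∈ in
                      m∤n (subst (_∣ n) content≡m (content∣n n (+ A) b c d (proj₁ p) (proj₂ p) r≥1 r∣n c⊥d))))) z≤n

    exact-count : ∀ m → 1 ≤ m → m ∣ n → countE n (+ A) b c d m ≡ n // m
    exact-count m m≥1 m∣n = begin
      countE n (+ A) b c d m               ≡⟨ countE≡fibre m ⟩
      fibre content m (indexPairs n)       ≡⟨ All.lookup fibres-agree (divisor∈candidates n≥1 m≥1 m∣n) ⟩
      fibre (cofactor n) m (indexPairs n)  ≡⟨ #-cofactor n≥1 m≥1 m∣n ⟩
      n // m                               ∎
      where
      open ≡-Reasoning
      fibres-agree : All (λ m′ → fibre content m′ (indexPairs n) ≡ fibre (cofactor n) m′ (indexPairs n)) (candidates n)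
      fibres-agree = fibres-dominated content (cofactor n) (candidates n) (candidates-unique n) (indexPairs n)
                       (All.tabulate content∈candidates) (All.tabulate cofactor∈candidates)
                       (All.tabulate content-dominated)

theorem2 : (b n d c : ℕ) (a : ℤ) →
    4 ℕ.≤ b → 1 ℕ.≤ n → 1 ℕ.≤ d →
    d ^ 3 ℕ.< b →
    c ℕ.< d → gcd c d ≡ 1 →
    (+ 0) ℤ.≤ (+ b) ℤ.- (+ (d ^ 3 ℕ.* (n ^ 3 ℕ.+ n ^ 2))) →
    (+ (4 ℕ.* n ^ 5 ℕ.* d ^ 6)) ℤ.≤ ((+ b) ℤ.- (+ (d ^ 3 ℕ.* (n ^ 3 ℕ.+ n ^ 2)))) ℤ.* ((+ b) ℤ.- (+ (d ^ 3 ℕ.* (n ^ 3 ℕ.+ n ^ 2)))) →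
    gcd ∣ a ∣ b ≡ 1 →
    (+ 0) ℤ.< a ℤ.* (+ d) ℤ.- (+ b) ℤ.* (+ c) →
    (+ n) ℤ.* (+ n) ℤ.* ((a ℤ.* (+ d) ℤ.- (+ b) ℤ.* (+ c) ℤ.+ (+ d)) ℤ.* (a ℤ.* (+ d) ℤ.- (+ b) ℤ.* (+ c) ℤ.+ (+ d))) ℤ.* (+ d) ℤ.≤ (+ b) →
    ((r j : ℕ) → 1 ℕ.≤ r → r ∣ n → j ℕ.< r → mm n a b c d r j ∣ n)
    × ((m : ℕ) → 1 ℕ.≤ m → m ∣ n → countE n a b c d m ≡ n // m)
theorem2 b n d c a b≥4 n≥1 d≥1 _ _ c⊥d _ _ _ Q>0 _ with ExactCount.nonnegative {a} {b} {c} {d} d≥1 Q>0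
... | A , refl =
  (λ r j r≥1 r∣n _ → ContentDividesN.content∣n n (+ A) b c d r j r≥1 r∣n c⊥d) ,
  ExactCount.exact-count n A b c d n≥1 b≥1 d≥1 c⊥d Q>0
  where
  b≥1 : 1 ℕ.≤ b
  b≥1 = ≤-trans (ℕ.s≤s ℕ.z≤n) b≥4
    where open import Data.Nat.Properties using (≤-trans)
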